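{- Let $n\ge 2$ with $n\equiv 2\pmod 4$, let $d\ge0$, and let $C$ be an $n\times n$ circulant matrix with generator $(c_0,\ldots,c_{n-1})$ such that $c_0=d$, $c_j\in\{1,-1\}$ for $j=1,\ldots,n-1$, and $CC^T=(d^2+n-1)I$. Then $$\left(\sum_{j=1}^{n/2}c_{2j-1}\right)^2=d^2+n-1.$$
   Context: A circulant matrix of order $n$ with generator $(c_0,c_1,\ldots,c_{n-1})$ is the $n\times n$ matrix whose entry in row $i$ and column $j$ (indices $0,\ldots,n-1$) is $c_{(j-i)\bmod n}$.
   Formalization: The diagonal value d is rational instead of real, so the generator and the circulant matrix $C$ have rational entries. -}

module Defs where

open import Data.Nat using (ℕ; zero; suc; NonZero)
open import Data.Nat.DivMod using (_%_)
open import Data.Rational using (ℚ; 0ℚ; 1ℚ; _+_; _*_)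

sumTo : ℕ → (ℕ → ℚ) → ℚ
sumTo zero    f = 0ℚ
sumTo (suc m) f = sumTo m f + f m

δ : ℕ → ℕ → ℚ
δ zero    zero    = 1ℚ
δ zero    (suc _) = 0ℚ
δ (suc _) zero    = 0ℚ
δ (suc i) (suc j) = δ i j

-- Circulant matrix of order n with generator c (read on indices 0..n-1):
-- entry (i , j) is c ((j - i) mod n), computed as (n + j - i) mod n for i, j < n.
circulant : (n : ℕ) .{{_ : NonZero n}} → (ℕ → ℚ) → ℕ → ℕ → ℚ
circulant n c i j = c ((n Data.Nat.+ j Data.Nat.∸ i) % n)

mulTranspose : ℕ → (ℕ → ℕ → ℚ) → ℕ → ℕ → ℚ
mulTranspose n A i k = sumTo n (λ j → A i j * A k j)

open import Data.Integer using (+_)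
import Data.Rational as Q

ℕtoℚ : ℕ → ℚ
ℕtoℚ m = (+ m) Q./ 1

-- Weight row 0 of CCᵀ = L·I by a ±1-valued character w of ℤ/n. Because C is circulant the
-- weighted sum factors as (Σ w_j c_j)², while the right-hand side gives w 0 · L = L. For
-- n = 2h the trivial character and k ↦ (−1)^k give (E + O)² = L = (E − O)², where E and O
-- are the sums of the even- and odd-indexed c_j; hence E O = 0. O is a sum of h signs with
-- h odd, so O ≠ 0, whence E = 0 and O² = L.
module Submission where

open import Defs
open import Data.Nat using (ℕ; NonZero; _≥_; _<_; _≤_; _∸_; _*_; _+_)
open import Data.Nat.DivMod using (_%_; _/_)
open import Data.Rational using (ℚ; 0ℚ; 1ℚ; -_)
import Data.Rational as Q
open import Data.Sum using (_⊎_)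
open import Relation.Binary.PropositionalEquality using (_≡_)

open import Data.Nat using (zero; suc; z≤n; s≤s; _≤?_)
import Data.Nat.Properties as ℕ
import Data.Nat.DivMod as ℕ
import Data.Nat.Tactic.RingSolver as ℕ
import Data.Rational.Properties as QP
import Data.Rational.Unnormalised as ℚᵘ
import Data.Rational.Unnormalised.Properties as ℚᵘP
import Data.Integer as ℤ
import Data.Integer.Properties as ℤP
open import Data.Sum using (inj₁; inj₂)
open import Data.Product using (_,_; ∃-syntax)
open import Level using (0ℓ)
open import Relation.Nullary using (yes; no)
open import Relation.Nullary.Decidable using (dec⇒maybe)
open import Relation.Binary.PropositionalEquality
  using (_≢_; refl; sym; trans; cong; cong₂; subst; subst₂; module ≡-Reasoning)
open import Tactic.RingSolver using (solve-∀)
open import Tactic.RingSolver.Core.AlmostCommutativeRing using (AlmostCommutativeRing; fromCommutativeRing)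

open ≡-Reasoning

ℚ-ring : AlmostCommutativeRing 0ℓ 0ℓ
ℚ-ring = fromCommutativeRing QP.+-*-commutativeRing (λ p → dec⇒maybe (0ℚ QP.≟ p))

p*q≡0⇒p≡0 : ∀ p q → q ≢ 0ℚ → p Q.* q ≡ 0ℚ → p ≡ 0ℚ
p*q≡0⇒p≡0 p q q≢0 pq≡0 = begin
  p                        ≡⟨ sym (QP.*-identityʳ p) ⟩
  p Q.* 1ℚ                 ≡⟨ cong (p Q.*_) (sym (QP.*-inverseʳ q)) ⟩
  p Q.* (q Q.* q⁻¹)        ≡⟨ sym (QP.*-assoc p q q⁻¹) ⟩
  (p Q.* q) Q.* q⁻¹        ≡⟨ cong (Q._* q⁻¹) pq≡0 ⟩
  0ℚ Q.* q⁻¹               ≡⟨ QP.*-zeroˡ q⁻¹ ⟩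
  0ℚ                       ∎
  where
  instance
    q-nonZero : Q.NonZero q
    q-nonZero = Q.≢-nonZero q≢0
  q⁻¹ = Q.1/ q

[x+y]²≡[x-y]²⇒x≡0 : ∀ x y → y ≢ 0ℚ →
  (x Q.+ y) Q.* (x Q.+ y) ≡ (x Q.+ - y) Q.* (x Q.+ - y) → x ≡ 0ℚ
[x+y]²≡[x-y]²⇒x≡0 x y y≢0 sq≡sq =
  p*q≡0⇒p≡0 x y y≢0 (p*q≡0⇒p≡0 (x Q.* y) four (λ ()) (begin
    (x Q.* y) Q.* four                                              ≡⟨ difference x y ⟩
    (x Q.+ y) Q.* (x Q.+ y) Q.+ - ((x Q.+ - y) Q.* (x Q.+ - y))     ≡⟨ cong (λ z → z Q.+ - ((x Q.+ - y) Q.* (x Q.+ - y))) sq≡sq ⟩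
    (x Q.+ - y) Q.* (x Q.+ - y) Q.+ - ((x Q.+ - y) Q.* (x Q.+ - y)) ≡⟨ QP.+-inverseʳ ((x Q.+ - y) Q.* (x Q.+ - y)) ⟩
    0ℚ                                                              ∎))
  where
  four = 1ℚ Q.+ 1ℚ Q.+ 1ℚ Q.+ 1ℚ
  difference : ∀ x y → (x Q.* y) Q.* (1ℚ Q.+ 1ℚ Q.+ 1ℚ Q.+ 1ℚ)
             ≡ (x Q.+ y) Q.* (x Q.+ y) Q.+ - ((x Q.+ - y) Q.* (x Q.+ - y))
  difference = solve-∀ ℚ-ring

toℚᵘ-ℕtoℚ : ∀ m → Q.toℚᵘ (ℕtoℚ m) ℚᵘ.≃ ℚᵘ.mkℚᵘ (ℤ.+ m) 0
toℚᵘ-ℕtoℚ m = QP.toℚᵘ-fromℚᵘ (ℚᵘ.mkℚᵘ (ℤ.+ m) 0)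

ℕtoℚ-+ : ∀ a b → ℕtoℚ (a + b) ≡ ℕtoℚ a Q.+ ℕtoℚ b
ℕtoℚ-+ a b = QP.toℚᵘ-injective
  (ℚᵘP.≃-trans (toℚᵘ-ℕtoℚ (a + b))
  (ℚᵘP.≃-trans (ℚᵘ.*≡* eq)
  (ℚᵘP.≃-trans (ℚᵘP.+-cong (ℚᵘP.≃-sym (toℚᵘ-ℕtoℚ a)) (ℚᵘP.≃-sym (toℚᵘ-ℕtoℚ b)))
               (ℚᵘP.≃-sym (QP.toℚᵘ-homo-+ (ℕtoℚ a) (ℕtoℚ b))))))
  where
  eq : ℤ.+ (a + b) ℤ.* ℤ.+ 1 ≡ (ℤ.+ a ℤ.* ℤ.+ 1 ℤ.+ ℤ.+ b ℤ.* ℤ.+ 1) ℤ.* ℤ.+ 1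
  eq = cong (ℤ._* ℤ.+ 1) (trans (ℤP.pos-+ a b)
             (sym (cong₂ ℤ._+_ (ℤP.*-identityʳ (ℤ.+ a)) (ℤP.*-identityʳ (ℤ.+ b)))))

ℕtoℚ-suc : ∀ a → ℕtoℚ (suc a) ≡ ℕtoℚ a Q.+ 1ℚ
ℕtoℚ-suc a = trans (cong ℕtoℚ (ℕ.+-comm 1 a)) (ℕtoℚ-+ a 1)

ℕtoℚ-injective : ∀ {a b} → ℕtoℚ a ≡ ℕtoℚ b → a ≡ b
ℕtoℚ-injective {a} {b} eq
  with ℚᵘP.≃-trans (ℚᵘP.≃-sym (toℚᵘ-ℕtoℚ a)) (ℚᵘP.≃-trans (QP.toℚᵘ-cong eq) (toℚᵘ-ℕtoℚ b))
... | ℚᵘ.*≡* a*1≡b*1 =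
  ℤP.+-injective (trans (sym (ℤP.*-identityʳ (ℤ.+ a))) (trans a*1≡b*1 (ℤP.*-identityʳ (ℤ.+ b))))

sumTo-cong : ∀ m {f g : ℕ → ℚ} → (∀ i → i < m → f i ≡ g i) → sumTo m f ≡ sumTo m g
sumTo-cong zero    f≡g = refl
sumTo-cong (suc m) f≡g = cong₂ Q._+_ (sumTo-cong m (λ i i<m → f≡g i (ℕ.m<n⇒m<1+n i<m))) (f≡g m ℕ.≤-refl)

sumTo-0 : ∀ m → sumTo m (λ _ → 0ℚ) ≡ 0ℚ
sumTo-0 zero    = refl
sumTo-0 (suc m) = trans (QP.+-identityʳ _) (sumTo-0 m)

sumTo-+ : ∀ m (f g : ℕ → ℚ) → sumTo m (λ i → f i Q.+ g i) ≡ sumTo m f Q.+ sumTo m g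
sumTo-+ zero    f g = refl
sumTo-+ (suc m) f g = begin
  sumTo m (λ i → f i Q.+ g i) Q.+ (f m Q.+ g m)    ≡⟨ cong (Q._+ (f m Q.+ g m)) (sumTo-+ m f g) ⟩
  (sumTo m f Q.+ sumTo m g) Q.+ (f m Q.+ g m)      ≡⟨ interchange (sumTo m f) (sumTo m g) (f m) (g m) ⟩
  (sumTo m f Q.+ f m) Q.+ (sumTo m g Q.+ g m)      ∎
  where
  interchange : ∀ a b c d → (a Q.+ b) Q.+ (c Q.+ d) ≡ (a Q.+ c) Q.+ (b Q.+ d)
  interchange = solve-∀ ℚ-ring

sumTo-neg : ∀ m (f : ℕ → ℚ) → sumTo m (λ i → - f i) ≡ - sumTo m f
sumTo-neg zero    f = refl
sumTo-neg (suc m) f = trans (cong (Q._+ (- f m)) (sumTo-neg m f)) (sym (QP.neg-distrib-+ (sumTo m f) (f m)))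

sumTo-*ˡ : ∀ m a (f : ℕ → ℚ) → sumTo m (λ i → a Q.* f i) ≡ a Q.* sumTo m f
sumTo-*ˡ zero    a f = sym (QP.*-zeroʳ a)
sumTo-*ˡ (suc m) a f = trans (cong (Q._+ (a Q.* f m)) (sumTo-*ˡ m a f)) (sym (QP.*-distribˡ-+ a (sumTo m f) (f m)))

sumTo-*ʳ : ∀ m a (f : ℕ → ℚ) → sumTo m (λ i → f i Q.* a) ≡ sumTo m f Q.* a
sumTo-*ʳ m a f = begin
  sumTo m (λ i → f i Q.* a)  ≡⟨ sumTo-cong m (λ i _ → QP.*-comm (f i) a) ⟩
  sumTo m (λ i → a Q.* f i)  ≡⟨ sumTo-*ˡ m a f ⟩
  a Q.* sumTo m f            ≡⟨ QP.*-comm a (sumTo m f) ⟩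
  sumTo m f Q.* a            ∎

sumTo-swap : ∀ m p (F : ℕ → ℕ → ℚ) →
  sumTo m (λ i → sumTo p (F i)) ≡ sumTo p (λ j → sumTo m (λ i → F i j))
sumTo-swap zero    p F = sym (sumTo-0 p)
sumTo-swap (suc m) p F = trans (cong (Q._+ sumTo p (F m)) (sumTo-swap m p F))
                               (sym (sumTo-+ p (λ j → sumTo m (λ i → F i j)) (F m)))

sumTo-split : ∀ a b (f : ℕ → ℚ) → sumTo (a + b) f ≡ sumTo a f Q.+ sumTo b (λ i → f (a + i))
sumTo-split a zero    f rewrite ℕ.+-identityʳ a = sym (QP.+-identityʳ _)
sumTo-split a (suc b) f rewrite ℕ.+-suc a b =
  trans (cong (Q._+ f (a + b)) (sumTo-split a b f)) (QP.+-assoc (sumTo a f) _ (f (a + b)))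

sumTo-reverse : ∀ m (f : ℕ → ℚ) → sumTo m (λ i → f (m ∸ suc i)) ≡ sumTo m f
sumTo-reverse zero    f = refl
sumTo-reverse (suc m) f = begin
  sumTo (1 + m) (λ i → f (suc m ∸ suc i))             ≡⟨ sumTo-split 1 m _ ⟩
  (0ℚ Q.+ f m) Q.+ sumTo m (λ i → f (m ∸ suc i))     ≡⟨ cong₂ Q._+_ (QP.+-identityˡ (f m)) (sumTo-reverse m f) ⟩
  f m Q.+ sumTo m f                                   ≡⟨ QP.+-comm (f m) (sumTo m f) ⟩
  sumTo m f Q.+ f m                                   ∎

sumTo-*δ₀ : ∀ m .{{_ : NonZero m}} (f : ℕ → ℚ) → sumTo m (λ k → f k Q.* δ 0 k) ≡ f 0
sumTo-*δ₀ (suc zero)    f = trans (QP.+-identityˡ _) (QP.*-identityʳ (f 0))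
sumTo-*δ₀ (suc (suc m)) f = trans (cong₂ Q._+_ (sumTo-*δ₀ (suc m) f) (QP.*-zeroʳ (f (suc m)))) (QP.+-identityʳ _)

sumTo-even+odd : ∀ h (f : ℕ → ℚ) →
  sumTo (2 * h) f ≡ sumTo h (λ i → f (2 * i)) Q.+ sumTo h (λ i → f (2 * i + 1))
sumTo-even+odd h f = trans (pairs h) (sumTo-+ h (λ i → f (2 * i)) (λ i → f (2 * i + 1)))
  where
  pairs : ∀ h → sumTo (2 * h) f ≡ sumTo h (λ i → f (2 * i) Q.+ f (2 * i + 1))
  pairs zero    = refl
  pairs (suc h) = begin
    sumTo (2 * suc h) f                                          ≡⟨ cong (λ m → sumTo m f) (ℕ.*-suc 2 h) ⟩
    (sumTo (2 * h) f Q.+ f (2 * h)) Q.+ f (suc (2 * h))          ≡⟨ QP.+-assoc (sumTo (2 * h) f) _ _ ⟩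
    sumTo (2 * h) f Q.+ (f (2 * h) Q.+ f (suc (2 * h)))          ≡⟨ cong₂ Q._+_ (pairs h) (cong (λ k → f (2 * h) Q.+ f k) (ℕ.+-comm 1 (2 * h))) ⟩
    sumTo h (λ i → f (2 * i) Q.+ f (2 * i + 1)) Q.+ (f (2 * h) Q.+ f (2 * h + 1)) ∎

-- a counts the entries equal to - 1.
±1-sum : ∀ l (f : ℕ → ℚ) → (∀ i → i < l → (f i ≡ 1ℚ) ⊎ (f i ≡ - 1ℚ)) →
  ∃[ a ] sumTo l f Q.+ ℕtoℚ (2 * a) ≡ ℕtoℚ l
±1-sum zero    f ±1 = 0 , refl
±1-sum (suc l) f ±1 with ±1-sum l f (λ i i<l → ±1 i (ℕ.m<n⇒m<1+n i<l)) | ±1 l ℕ.≤-refl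
... | a , eq | inj₁ fl≡1 = a , (begin
  (sumTo l f Q.+ f l) Q.+ ℕtoℚ (2 * a)      ≡⟨ cong (λ x → (sumTo l f Q.+ x) Q.+ ℕtoℚ (2 * a)) fl≡1 ⟩
  (sumTo l f Q.+ 1ℚ) Q.+ ℕtoℚ (2 * a)       ≡⟨ plus (sumTo l f) (ℕtoℚ (2 * a)) ⟩
  (sumTo l f Q.+ ℕtoℚ (2 * a)) Q.+ 1ℚ       ≡⟨ cong (Q._+ 1ℚ) eq ⟩
  ℕtoℚ l Q.+ 1ℚ                             ≡⟨ ℕtoℚ-suc l ⟨
  ℕtoℚ (suc l)                               ∎)
  where
  plus : ∀ s N → (s Q.+ 1ℚ) Q.+ N ≡ (s Q.+ N) Q.+ 1ℚ
  plus = solve-∀ ℚ-ring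
... | a , eq | inj₂ fl≡-1 = suc a , (begin
  (sumTo l f Q.+ f l) Q.+ ℕtoℚ (2 * suc a)                ≡⟨ cong₂ (λ x m → (sumTo l f Q.+ x) Q.+ ℕtoℚ m) fl≡-1 (ℕ.*-suc 2 a) ⟩
  (sumTo l f Q.+ - 1ℚ) Q.+ ℕtoℚ (2 + 2 * a)               ≡⟨ cong ((sumTo l f Q.+ - 1ℚ) Q.+_) (ℕtoℚ-+ 2 (2 * a)) ⟩
  (sumTo l f Q.+ - 1ℚ) Q.+ (ℕtoℚ 2 Q.+ ℕtoℚ (2 * a))      ≡⟨ minus (sumTo l f) (ℕtoℚ (2 * a)) ⟩
  (sumTo l f Q.+ ℕtoℚ (2 * a)) Q.+ 1ℚ                     ≡⟨ cong (Q._+ 1ℚ) eq ⟩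
  ℕtoℚ l Q.+ 1ℚ                                           ≡⟨ ℕtoℚ-suc l ⟨
  ℕtoℚ (suc l)                                             ∎)
  where
  minus : ∀ s N → (s Q.+ - 1ℚ) Q.+ (ℕtoℚ 2 Q.+ N) ≡ (s Q.+ N) Q.+ 1ℚ
  minus = solve-∀ ℚ-ring

±1-sum-odd≢0 : ∀ q (f : ℕ → ℚ) → (∀ i → i < suc (2 * q) → (f i ≡ 1ℚ) ⊎ (f i ≡ - 1ℚ)) →
  sumTo (suc (2 * q)) f ≢ 0ℚ
±1-sum-odd≢0 q f ±1 sum≡0 with ±1-sum (suc (2 * q)) f ±1
... | a , eq = ℕ.even≢odd a q (ℕtoℚ-injective (trans (sym (QP.+-identityˡ _)) (trans (cong (Q._+ _) (sym sum≡0)) eq)))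

diffMod : (n : ℕ) .{{_ : NonZero n}} → ℕ → ℕ → ℕ
diffMod n j k = (n + j ∸ k) % n

diffMod-≤ : ∀ n .{{_ : NonZero n}} {j k} → k ≤ j → j < n → diffMod n j k ≡ j ∸ k
diffMod-≤ n {j} {k} k≤j j<n = begin
  (n + j ∸ k) % n  ≡⟨ cong (_% n) (trans (ℕ.+-∸-assoc n k≤j) (ℕ.+-comm n (j ∸ k))) ⟩
  (j ∸ k + n) % n  ≡⟨ ℕ.[m+n]%n≡m%n (j ∸ k) n ⟩
  (j ∸ k) % n      ≡⟨ ℕ.m<n⇒m%n≡m (ℕ.≤-<-trans (ℕ.m∸n≤m j k) j<n) ⟩
  j ∸ k            ∎

diffMod-> : ∀ n .{{_ : NonZero n}} {j k} → j < k → k < n → diffMod n j k ≡ n + j ∸ k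
diffMod-> n {j} {k} j<k k<n = ℕ.m<n⇒m%n≡m (ℕ.+-cancelʳ-< k (n + j ∸ k) n n+j∸k+k<n+k)
  where
  n+j∸k+k<n+k : n + j ∸ k + k < n + k
  n+j∸k+k<n+k rewrite ℕ.m∸n+n≡m (ℕ.≤-trans (ℕ.<⇒≤ k<n) (ℕ.m≤m+n n j)) = ℕ.+-monoʳ-< n j<k

private
  -- k ↦ (j − k) mod n reverses each of the blocks [0, j] and [j + 1, n).
  sumTo-diffMod′ : ∀ j r (g : ℕ → ℚ) →
    sumTo (suc j + r) (λ k → g (diffMod (suc j + r) j k)) ≡ sumTo (suc j + r) g
  sumTo-diffMod′ j r g = begin
    sumTo (suc j + r) G                                          ≡⟨ sumTo-split (suc j) r G ⟩
    sumTo (suc j) G Q.+ sumTo r (λ i → G (suc j + i))            ≡⟨ cong₂ Q._+_ low high ⟩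
    sumTo (suc j) g Q.+ sumTo r (λ i → g (suc j + i))            ≡⟨ sumTo-split (suc j) r g ⟨
    sumTo (suc j + r) g                                          ∎
    where
    n = suc j + r
    G : ℕ → ℚ
    G k = g (diffMod n j k)
    low : sumTo (suc j) G ≡ sumTo (suc j) g
    low = trans (sumTo-cong (suc j) (λ k k<1+j → cong g (diffMod-≤ n (ℕ.≤-pred k<1+j) (s≤s (ℕ.m≤m+n j r)))))
                (sumTo-reverse (suc j) g)
    shift : ∀ i t → suc j + (suc i + t) + j ∸ (suc j + i) ≡ suc j + t
    shift i t = trans (cong (_∸ (suc j + i)) (reassoc j i t)) (ℕ.m+n∸m≡n (suc j + i) (suc j + t))
      where
      reassoc : ∀ a b t → suc a + (suc b + t) + a ≡ (suc a + b) + (suc a + t)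
      reassoc = ℕ.solve-∀
    high-index : ∀ i → i < r → diffMod n j (suc j + i) ≡ suc j + (r ∸ suc i)
    high-index i i<r = begin
      diffMod n j (suc j + i)     ≡⟨ diffMod-> n (s≤s (ℕ.m≤m+n j i)) (ℕ.+-monoʳ-< (suc j) i<r) ⟩
      n + j ∸ (suc j + i)         ≡⟨ cong (λ r′ → suc j + r′ + j ∸ (suc j + i)) (sym (ℕ.m+[n∸m]≡n i<r)) ⟩
      suc j + (suc i + (r ∸ suc i)) + j ∸ (suc j + i) ≡⟨ shift i (r ∸ suc i) ⟩
      suc j + (r ∸ suc i)         ∎
    high : sumTo r (λ i → G (suc j + i)) ≡ sumTo r (λ i → g (suc j + i))
    high = trans (sumTo-cong r (λ i i<r → cong g (high-index i i<r))) (sumTo-reverse r (λ i → g (suc j + i)))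

sumTo-diffMod : ∀ n .{{_ : NonZero n}} {j} → j < n → (g : ℕ → ℚ) →
  sumTo n (λ k → g (diffMod n j k)) ≡ sumTo n g
sumTo-diffMod n {j} j<n g = subst (λ m → ∀ .{{_ : NonZero m}} → sumTo m (λ k → g (diffMod m j k)) ≡ sumTo m g)
  (ℕ.m+[n∸m]≡n j<n) (sumTo-diffMod′ j (n ∸ suc j) g)

record IsSignCharacter (n : ℕ) (w : ℕ → ℚ) : Set where
  field
    homo     : ∀ a b → w (a + b) ≡ w a Q.* w b
    periodic : w n ≡ 1ℚ
    square   : ∀ a → w a Q.* w a ≡ 1ℚ

  w0≡1 : w 0 ≡ 1ℚ
  w0≡1 = trans (homo 0 0) (square 0)

  private
    move : ∀ {a b x} → w a ≡ w b Q.* w x → w b ≡ w a Q.* w x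
    move {a} {b} {x} wa≡wbwx = sym (begin
      w a Q.* w x              ≡⟨ cong (Q._* w x) wa≡wbwx ⟩
      (w b Q.* w x) Q.* w x    ≡⟨ QP.*-assoc (w b) (w x) (w x) ⟩
      w b Q.* (w x Q.* w x)    ≡⟨ cong (w b Q.*_) (square x) ⟩
      w b Q.* 1ℚ               ≡⟨ QP.*-identityʳ (w b) ⟩
      w b                      ∎)

  w-diffMod : ∀ .{{_ : NonZero n}} {j k} → j < n → k < n → w k ≡ w j Q.* w (diffMod n j k)
  w-diffMod {j} {k} j<n k<n with k ≤? j
  ... | yes k≤j rewrite diffMod-≤ n k≤j j<n =
    move (trans (cong w (sym (ℕ.m+[n∸m]≡n k≤j))) (homo k (j ∸ k)))
  ... | no  k≰j rewrite diffMod-> n (ℕ.≰⇒> k≰j) k<n = move (begin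
    w j                        ≡⟨ sym (QP.*-identityˡ (w j)) ⟩
    1ℚ Q.* w j                 ≡⟨ cong (Q._* w j) (sym periodic) ⟩
    w n Q.* w j                ≡⟨ sym (homo n j) ⟩
    w (n + j)                  ≡⟨ cong w (sym (ℕ.m∸n+n≡m (ℕ.≤-trans (ℕ.<⇒≤ k<n) (ℕ.m≤m+n n j)))) ⟩
    w (n + j ∸ k + k)          ≡⟨ trans (homo (n + j ∸ k) k) (QP.*-comm _ (w k)) ⟩
    w k Q.* w (n + j ∸ k)      ∎)

weightedSum : ℕ → (ℕ → ℚ) → (ℕ → ℚ) → ℚ
weightedSum n w c = sumTo n (λ m → w m Q.* c m)

weightedSum-row₀-CCᵀ : ∀ n .{{_ : NonZero n}} {w} → IsSignCharacter n w → ∀ c →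
  weightedSum n w (mulTranspose n (circulant n c) 0) ≡ weightedSum n w c Q.* weightedSum n w c
weightedSum-row₀-CCᵀ n {w} χ c = begin
  sumTo n (λ k → w k Q.* sumTo n (λ j → c (dm j 0) Q.* c (dm j k)))
    ≡⟨ sumTo-cong n (λ k _ → sym (sumTo-*ˡ n (w k) _)) ⟩
  sumTo n (λ k → sumTo n (λ j → w k Q.* (c (dm j 0) Q.* c (dm j k))))
    ≡⟨ sumTo-swap n n _ ⟩
  sumTo n (λ j → sumTo n (λ k → w k Q.* (c (dm j 0) Q.* c (dm j k))))
    ≡⟨ sumTo-cong n row ⟩
  sumTo n (λ j → (w j Q.* c j) Q.* S)
    ≡⟨ sumTo-*ʳ n S (λ j → w j Q.* c j) ⟩
  S Q.* S ∎
  where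
  open IsSignCharacter χ
  dm = diffMod n
  S = weightedSum n w c
  regroup : ∀ a b x y → (a Q.* b) Q.* (x Q.* y) ≡ (a Q.* x) Q.* (b Q.* y)
  regroup = solve-∀ ℚ-ring
  term : ∀ j k → j < n → k < n → w k Q.* (c (dm j 0) Q.* c (dm j k)) ≡ (w j Q.* c j) Q.* (w (dm j k) Q.* c (dm j k))
  term j k j<n k<n rewrite w-diffMod j<n k<n | diffMod-≤ n z≤n j<n = regroup (w j) _ (c j) _
  row : ∀ j → j < n → sumTo n (λ k → w k Q.* (c (dm j 0) Q.* c (dm j k))) ≡ (w j Q.* c j) Q.* S
  row j j<n = begin
    sumTo n (λ k → w k Q.* (c (dm j 0) Q.* c (dm j k)))            ≡⟨ sumTo-cong n (λ k → term j k j<n) ⟩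
    sumTo n (λ k → (w j Q.* c j) Q.* (w (dm j k) Q.* c (dm j k)))  ≡⟨ sumTo-*ˡ n (w j Q.* c j) _ ⟩
    (w j Q.* c j) Q.* sumTo n (λ k → w (dm j k) Q.* c (dm j k))
      ≡⟨ cong ((w j Q.* c j) Q.*_) (sumTo-diffMod n j<n (λ m → w m Q.* c m)) ⟩
    (w j Q.* c j) Q.* S                                             ∎

weightedSum² : ∀ n .{{_ : NonZero n}} {w} → IsSignCharacter n w → ∀ c L →
  (∀ k → k < n → mulTranspose n (circulant n c) 0 k ≡ L Q.* δ 0 k) →
  weightedSum n w c Q.* weightedSum n w c ≡ L
weightedSum² n {w} χ c L row₀ = begin
  weightedSum n w c Q.* weightedSum n w c               ≡⟨ weightedSum-row₀-CCᵀ n χ c ⟨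
  weightedSum n w (mulTranspose n (circulant n c) 0)    ≡⟨ sumTo-cong n (λ k k<n → cong (w k Q.*_) (row₀ k k<n)) ⟩
  sumTo n (λ k → w k Q.* (L Q.* δ 0 k))                  ≡⟨ sumTo-cong n (λ k _ → sym (QP.*-assoc (w k) L (δ 0 k))) ⟩
  sumTo n (λ k → (w k Q.* L) Q.* δ 0 k)                  ≡⟨ sumTo-*δ₀ n (λ k → w k Q.* L) ⟩
  w 0 Q.* L                                              ≡⟨ cong (Q._* L) (IsSignCharacter.w0≡1 χ) ⟩
  1ℚ Q.* L                                               ≡⟨ QP.*-identityˡ L ⟩
  L                                                      ∎

1-isSignCharacter : ∀ n → IsSignCharacter n (λ _ → 1ℚ)
1-isSignCharacter n = record { homo = λ _ _ → refl ; periodic = refl ; square = λ _ → refl }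

sign : ℕ → ℚ
sign zero    = 1ℚ
sign (suc k) = - sign k

sign-+ : ∀ a b → sign (a + b) ≡ sign a Q.* sign b
sign-+ zero    b = sym (QP.*-identityˡ (sign b))
sign-+ (suc a) b = trans (cong -_ (sign-+ a b)) (QP.neg-distribˡ-* (sign a) (sign b))

sign-square : ∀ a → sign a Q.* sign a ≡ 1ℚ
sign-square zero    = refl
sign-square (suc a) = trans (neg*neg (sign a)) (sign-square a)
  where
  neg*neg : ∀ x → (- x) Q.* (- x) ≡ x Q.* x
  neg*neg = solve-∀ ℚ-ring

sign-even : ∀ q → sign (2 * q) ≡ 1ℚ
sign-even q = begin
  sign (q + (q + 0))        ≡⟨ cong (λ m → sign (q + m)) (ℕ.+-identityʳ q) ⟩
  sign (q + q)              ≡⟨ sign-+ q q ⟩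
  sign q Q.* sign q         ≡⟨ sign-square q ⟩
  1ℚ                        ∎

sign-odd : ∀ q → sign (2 * q + 1) ≡ - 1ℚ
sign-odd q = trans (sign-+ (2 * q) 1) (trans (cong (Q._* - 1ℚ) (sign-even q)) (QP.*-identityˡ (- 1ℚ)))

sign-isSignCharacter : ∀ {n} → sign n ≡ 1ℚ → IsSignCharacter n sign
sign-isSignCharacter sign-n≡1 = record { homo = sign-+ ; periodic = sign-n≡1 ; square = sign-square }

evenSum oddSum : ℕ → (ℕ → ℚ) → ℚ
evenSum h c = sumTo h (λ i → c (2 * i))
oddSum  h c = sumTo h (λ i → c (2 * i + 1))

weightedSum-1 : ∀ h c → weightedSum (2 * h) (λ _ → 1ℚ) c ≡ evenSum h c Q.+ oddSum h c
weightedSum-1 h c = trans (sumTo-even+odd h (λ m → 1ℚ Q.* c m))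
  (cong₂ Q._+_ (sumTo-cong h (λ i _ → QP.*-identityˡ (c (2 * i))))
               (sumTo-cong h (λ i _ → QP.*-identityˡ (c (2 * i + 1)))))

weightedSum-sign : ∀ h c → weightedSum (2 * h) sign c ≡ evenSum h c Q.+ - oddSum h c
weightedSum-sign h c = trans (sumTo-even+odd h (λ m → sign m Q.* c m)) (cong₂ Q._+_
  (sumTo-cong h (λ i _ → trans (cong (Q._* c (2 * i)) (sign-even i)) (QP.*-identityˡ (c (2 * i)))))
  (trans (sumTo-cong h (λ i _ → trans (cong (Q._* c (2 * i + 1)) (sign-odd i)) (-1*x≡-x (c (2 * i + 1)))))
         (sumTo-neg h (λ i → c (2 * i + 1)))))
  where
  -1*x≡-x : ∀ x → - 1ℚ Q.* x ≡ - x
  -1*x≡-x = solve-∀ ℚ-ring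

oddSum²-of-CCᵀ≡LI : ∀ n .{{_ : NonZero n}} q → n ≡ 2 * suc (2 * q) → ∀ c L →
  (∀ k → k < n → mulTranspose n (circulant n c) 0 k ≡ L Q.* δ 0 k) →
  (∀ i → i < suc (2 * q) → (c (2 * i + 1) ≡ 1ℚ) ⊎ (c (2 * i + 1) ≡ - 1ℚ)) →
  oddSum (suc (2 * q)) c Q.* oddSum (suc (2 * q)) c ≡ L
oddSum²-of-CCᵀ≡LI n q n≡2h c L row₀ ±1 = begin
  O Q.* O                    ≡⟨ cong (λ x → x Q.* x) (trans (cong (Q._+ O) E≡0) (QP.+-identityˡ O)) ⟨
  (E Q.+ O) Q.* (E Q.+ O)    ≡⟨ [E+O]²≡L ⟩
  L                          ∎
  where
  h = suc (2 * q)
  E = evenSum h c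
  O = oddSum h c
  square≡L : ∀ {w} x → IsSignCharacter n w → weightedSum (2 * h) w c ≡ x → x Q.* x ≡ L
  square≡L {w} x χ ws≡x = subst (λ y → y Q.* y ≡ L) (trans (cong (λ m → weightedSum m w c) n≡2h) ws≡x)
                                (weightedSum² n χ c L row₀)
  [E+O]²≡L : (E Q.+ O) Q.* (E Q.+ O) ≡ L
  [E+O]²≡L = square≡L (E Q.+ O) (1-isSignCharacter n) (weightedSum-1 h c)
  [E-O]²≡L : (E Q.+ - O) Q.* (E Q.+ - O) ≡ L
  [E-O]²≡L = square≡L (E Q.+ - O) (sign-isSignCharacter (trans (cong sign n≡2h) (sign-even h))) (weightedSum-sign h c)
  E≡0 : E ≡ 0ℚ
  E≡0 = [x+y]²≡[x-y]²⇒x≡0 E O (±1-sum-odd≢0 q (λ i → c (2 * i + 1)) ±1) (trans [E+O]²≡L (sym [E-O]²≡L))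

≡2-mod-4⇒≡2*odd : ∀ n → n % 4 ≡ 2 → n ≡ 2 * suc (2 * (n / 4))
≡2-mod-4⇒≡2*odd n n%4≡2 = begin
  n                          ≡⟨ ℕ.m≡m%n+[m/n]*n n 4 ⟩
  n % 4 + n / 4 * 4          ≡⟨ cong (_+ n / 4 * 4) n%4≡2 ⟩
  2 + n / 4 * 4              ≡⟨ regroup (n / 4) ⟩
  2 * suc (2 * (n / 4))      ∎
  where
  regroup : ∀ q → 2 + q * 4 ≡ 2 * suc (2 * q)
  regroup = ℕ.solve-∀

proposition3p7 : (n : ℕ) .{{_ : NonZero n}} → n ≥ 2 → n % 4 ≡ 2 →
    (d : ℚ) → 0ℚ Q.≤ d → (c : ℕ → ℚ) → c 0 ≡ d →
    (∀ j → 1 ≤ j → j < n → (c j ≡ 1ℚ) ⊎ (c j ≡ - 1ℚ)) →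
    (∀ i k → i < n → k < n →
    mulTranspose n (circulant n c) i k ≡ (d Q.* d Q.+ ℕtoℚ (n ∸ 1)) Q.* δ i k) →
    sumTo (n / 2) (λ j → c (2 * j + 1)) Q.* sumTo (n / 2) (λ j → c (2 * j + 1))
    ≡ d Q.* d Q.+ ℕtoℚ (n ∸ 1)
-- The hypotheses c 0 ≡ d and 0 ≤ d are not needed: the diagonal entry never enters the argument.
proposition3p7 n n≥2 n%4≡2 d _ c _ ±1 CCᵀ≡LI =
  subst (λ m → oddSum m c Q.* oddSum m c ≡ L) (sym n/2≡h)
    (oddSum²-of-CCᵀ≡LI n q n≡2h c L (λ k → CCᵀ≡LI 0 k (ℕ.<-≤-trans (s≤s z≤n) n≥2))
      (λ i i<h → ±1 (2 * i + 1) (ℕ.m≤n+m 1 (2 * i)) (odd<n i<h)))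
  where
  L = d Q.* d Q.+ ℕtoℚ (n ∸ 1)
  q = n / 4
  h = suc (2 * q)
  n≡2h : n ≡ 2 * h
  n≡2h = ≡2-mod-4⇒≡2*odd n n%4≡2
  n/2≡h : n / 2 ≡ h
  n/2≡h = trans (cong (_/ 2) (trans n≡2h (ℕ.*-comm 2 h))) (ℕ.m*n/n≡m h 2)
  odd<n : ∀ {i} → i < h → 2 * i + 1 < n
  odd<n {i} i<h = subst₂ _≤_ (trans (ℕ.*-suc 2 i) (cong suc (ℕ.+-comm 1 (2 * i)))) (sym n≡2h) (ℕ.*-monoʳ-≤ 2 i<h)
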